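{- Every corner trajectory has full rank.
   Context: $\mathcal{B}\subset\mathbb{R}^2$ is a convex polygon with rational corners, interior $\mathcal{B}^\circ$, boundary $\partial\mathcal{B}$, sides on lines $\alpha_1x+\alpha_2y=\beta$. $\mathbb{P}$ is a two-move rider with nonparallel moves $\mathbf{m}_r=(c_r,d_r)$, $r=1,2$, with relatively prime integer coordinates. For $\mathbf{z}=(\mathbf{z}_1,\dots,\mathbf{z}_k)\in\mathbb{R}^{2k}$, $\mathcal{H}(\mathbf{z})$ is the set of hyperplanes containing $\mathbf{z}$ among attack equations $(\mathbf{z}_i-\mathbf{z}_j)\cdot(d_r,-c_r)=0$ ($i\ne j$) and fixations $(\alpha_1,\alpha_2)\cdot\mathbf{z}_i=\beta$; $\mathbf{z}$ has full rank if the system $\mathcal{H}(\mathbf{z})$ has rank $2k$. Antipode maps: $s_r(\mathbf{b})=\mathbf{b}$ if the line $\{\mathbf{b}+\lambda\mathbf{m}_r\}$ misses $\mathcal{B}^\circ$, else the other point where it meets $\partial\mathcal{B}$. An extended trajectory is a maximal sequence $(\mathbf{b}_i)$ in $\partial\mathcal{B}$ with $\mathbf{b}_{i+1}=s_{r_i}(\mathbf{b}_i)\ne\mathbf{b}_i$, $r_i$ alternating between $1$ and $2$. A trajectory $[\mathbf{b}_1,\dots,\mathbf{b}_l]$ is a finite consecutive subsequence of distinct points of an extended trajectory; it has full rank if $(\mathbf{b}_1,\dots,\mathbf{b}_l)$ does. A corner trajectory is a trajectory containing a corner of $\mathcal{B}$.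
   Formalization: Stated over the rational plane ℚ² in place of $\mathbb{R}^2$: the trajectory points, the parameter λ and the solution vectors of the system $\mathcal{H}(\mathbf{z})$ are all rational. -}

module Defs where

open import Data.Nat as ℕ using (ℕ; suc; _<?_)
open import Data.Nat.Coprimality using (Coprime)
open import Data.Integer as ℤ using (ℤ; ∣_∣)
open import Data.Rational using (ℚ; 0ℚ; _+_; _*_; _-_; _<_; _≤_; _/_)
open import Data.Fin using (Fin; zero; toℕ; fromℕ<) renaming (suc to Fsuc)
open import Data.Product using (_×_; _,_; proj₁; proj₂; Σ; ∃)
open import Data.Sum using (_⊎_)
open import Relation.Nullary using (¬_; yes; no)
open import Relation.Binary.PropositionalEquality using (_≡_; _≢_)

Pt : Set
Pt = ℚ × ℚ

infixl 6 _⊕_ _⊖_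
_⊕_ : Pt → Pt → Pt
(a , b) ⊕ (c , d) = (a + c , b + d)

_⊖_ : Pt → Pt → Pt
(a , b) ⊖ (c , d) = (a - c , b - d)

_·_ : ℚ → Pt → Pt
t · (a , b) = (t * a , t * b)

cross : Pt → Pt → ℚ
cross (a , b) (c , d) = a * d - b * c

dot : Pt → Pt → ℚ
dot (a , b) (c , d) = a * c + b * d

origin : Pt
origin = (0ℚ , 0ℚ)

next : ∀ {n} → Fin n → Fin n
next {suc n} i with suc (toℕ i) <? suc n
... | yes p = fromℕ< p
... | no _  = zero

-- Convex polygon with rational corners, given by its corners
-- corner 0, …, corner (n-1) in counterclockwise order, n ≥ 3.
-- Side j is the segment from corner j to corner (next j).

record Polygon : Set where
  field
    n        : ℕ
    3≤n      : 3 ℕ.≤ n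
    corner   : Fin n → Pt
    convex   : ∀ (j k : Fin n) → k ≢ j → k ≢ next j →
               0ℚ < cross (corner (next j) ⊖ corner j) (corner k ⊖ corner j)

module _ (B : Polygon) where
  open Polygon B

  edge : Fin n → Pt
  edge j = corner (next j) ⊖ corner j

  -- signed (scaled) distance of p to the line of side j;
  -- the line of side j is  sideForm j p ≡ 0ℚ,  i.e.  α₁x + α₂y = β
  -- with (α₁ , α₂) = (−e₂ , e₁),  e = edge j.
  sideForm : Fin n → Pt → ℚ
  sideForm j p = cross (edge j) (p ⊖ corner j)

  InB : Pt → Set
  InB p = ∀ j → 0ℚ ≤ sideForm j p

  Interior : Pt → Set
  Interior p = ∀ j → 0ℚ < sideForm j p

  Boundary : Pt → Set
  Boundary p = InB p × ∃ λ j → sideForm j p ≡ 0ℚ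

  IsCorner : Pt → Set
  IsCorner p = ∃ λ j → p ≡ corner j

record Rider : Set where
  field
    c d       : Fin 2 → ℤ
    coprime   : ∀ r → Coprime ∣ c r ∣ ∣ d r ∣
    nonparallel : ℤ._*_ (c zero) (d (Fsuc zero)) ≢ ℤ._*_ (c (Fsuc zero)) (d zero)
  move : Fin 2 → Pt
  move r = (c r / 1 , d r / 1)
  -- the vector (d_r , −c_r) of the attack equation
  attackNormal : Fin 2 → Pt
  attackNormal r = (d r / 1 , ℤ.- (c r) / 1)

module _ (B : Polygon) (P : Rider) where
  open Polygon B
  open Rider P

  MeetsInterior : Fin 2 → Pt → Set
  MeetsInterior r b = ∃ λ (t : ℚ) → Interior B (b ⊕ t · move r)

  -- Antipode r b b' : "s_r(b) = b'"  (for b ∈ ∂B)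
  Antipode : Fin 2 → Pt → Pt → Set
  Antipode r b b' =
      (¬ MeetsInterior r b × b' ≡ b)
    ⊎ (MeetsInterior r b × Boundary B b' × b' ≢ b ×
       ∃ λ (t : ℚ) → b' ≡ b ⊕ t · move r)

  record Trajectory (l : ℕ) (b : Fin l → Pt) : Set where
    field
      nonempty  : 1 ℕ.≤ l
      distinct  : ∀ i j → b i ≡ b j → i ≡ j
      onBoundary : ∀ i → Boundary B (b i)
      r         : Fin l → Fin 2
      alternate : ∀ i j → toℕ j ≡ suc (toℕ i) → r j ≢ r i
      step      : ∀ i j → toℕ j ≡ suc (toℕ i) →
                  Antipode (r i) (b i) (b j) × b j ≢ b i

  CornerTrajectory : (l : ℕ) → (Fin l → Pt) → Set
  CornerTrajectory l b = Trajectory l b × ∃ λ i → IsCorner B (b i)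

  -- Full rank of z = (z₁,…,z_k) ∈ ℚ^{2k}: the homogeneous linear system
  -- whose rows are the normal vectors of the hyperplanes of H(z)
  --   attack equations  (z_i − z_j)·(d_r, −c_r) = 0   (i ≠ j)
  --   fixations         (α₁,α₂)·z_i = β  (side lines of B)
  -- containing z has rank 2k, i.e. only the trivial solution w = 0.
  FullRank : (k : ℕ) → (Fin k → Pt) → Set
  FullRank k z =
    ∀ (w : Fin k → Pt) →
      (∀ i j r → i ≢ j → dot (z i ⊖ z j) (attackNormal r) ≡ 0ℚ →
                          dot (w i ⊖ w j) (attackNormal r) ≡ 0ℚ) →
      (∀ i s → sideForm B s (z i) ≡ 0ℚ → cross (edge B s) (w i) ≡ 0ℚ) →
      ∀ i → w i ≡ origin

-- A solution w of the homogeneous system H(b) vanishes at a corner, where the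
-- fixations of the two adjacent, nonparallel sides annihilate it. Vanishing
-- then spreads along the trajectory: if b' = s_r(b) ≠ b, the line b + λ m_r
-- passes through the interior, so it crosses every side line through b or b'
-- transversally. The attack equation between b and b' puts w(b') − w(b) on a
-- line of direction m_r, and the fixation of a side through b' (or b) puts
-- w(b') (or w(b)) on a transversal line, so w vanishes at b iff it does at b'.
module Submission where

open import Defs
open import Algebra.Properties.Group using (⁻¹-involutive)
open import Data.Nat as ℕ using (ℕ; suc; _<?_)
import Data.Nat.Properties as ℕ
import Data.Integer as ℤ
open import Data.Rational using (ℚ; 0ℚ; 1ℚ; _+_; _*_; _-_; -_; _<_; _/_; 1/_; ≢-nonZero)
open import Data.Rational.Properties
  using (+-*-commutativeRing; +-0-group; _≟_; *-inverseʳ; *-assoc; *-identityʳ; *-zeroˡ; *-zeroʳ; +-identityʳ; <-irrefl; <⇒≢)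
open import Data.Fin using (Fin; toℕ; fromℕ; inject₁) renaming (zero to fzero; suc to fsuc)
open import Data.Fin.Properties using (toℕ-fromℕ<; toℕ-fromℕ; toℕ-inject₁; toℕ-injective; toℕ<n)
open import Data.Fin.Induction using (<-weakInduction)
open import Data.Product using (_×_; _,_; proj₁; proj₂; ∃)
open import Data.Sum using (_⊎_; inj₁; inj₂)
open import Data.Empty using (⊥; ⊥-elim)
open import Function using (id; _∘_)
open import Level using (0ℓ)
open import Relation.Nullary using (yes; no)
open import Relation.Nullary.Decidable using (dec⇒maybe)
open import Relation.Binary.PropositionalEquality
open import Tactic.RingSolver using (solve-∀)
import Tactic.RingSolver.Core.AlmostCommutativeRing as ACR

open Rider using (move; attackNormal)
open ≡-Reasoning

-- The zero test lets the solver identify the literal 0ℚ with the ring's zero.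
ℚ-ring : ACR.AlmostCommutativeRing 0ℓ 0ℓ
ℚ-ring = ACR.fromCommutativeRing +-*-commutativeRing (λ p → dec⇒maybe (0ℚ ≟ p))

p*q≡0⇒p≡0 : ∀ p q → q ≢ 0ℚ → p * q ≡ 0ℚ → p ≡ 0ℚ
p*q≡0⇒p≡0 p q q≢0 pq≡0 = begin
  p              ≡⟨ sym (*-identityʳ p) ⟩
  p * 1ℚ         ≡⟨ cong (p *_) (sym (*-inverseʳ q)) ⟩
  p * (q * 1/ q) ≡⟨ sym (*-assoc p q (1/ q)) ⟩
  p * q * 1/ q   ≡⟨ cong (_* 1/ q) pq≡0 ⟩
  0ℚ * 1/ q      ≡⟨ *-zeroˡ (1/ q) ⟩
  0ℚ             ∎
  where
  instance
    q-nonZero = ≢-nonZero q≢0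

-‿/1 : ∀ z → (ℤ.- z) / 1 ≡ - (z / 1)
-‿/1 (ℤ.+ 0)     = refl
-‿/1 ℤ.+[1+ n ]  = refl
-‿/1 ℤ.-[1+ n ]  = sym (⁻¹-involutive +-0-group _)

⊖-origin : ∀ v → v ⊖ origin ≡ v
⊖-origin (x , y) = cong₂ _,_ (+-identityʳ x) (+-identityʳ y)

⊕-zero· : ∀ q m → q ⊕ 0ℚ · m ≡ q
⊕-zero· (q₁ , q₂) (m₁ , m₂) = cong₂ _,_ (identity q₁ m₁) (identity q₂ m₂)
  where
  identity : ∀ q m → q + 0ℚ * m ≡ q
  identity = solve-∀ ℚ-ring

cross-⊖-self : ∀ e x → cross e (x ⊖ x) ≡ 0ℚ
cross-⊖-self (e₁ , e₂) (x₁ , x₂) = identity e₁ e₂ x₁ x₂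
  where
  identity : ∀ e₁ e₂ x₁ x₂ → e₁ * (x₂ - x₂) - e₂ * (x₁ - x₁) ≡ 0ℚ
  identity = solve-∀ ℚ-ring

cross-rebase : ∀ a p x → cross (a ⊖ p) (x ⊖ p) ≡ cross (a ⊖ p) (x ⊖ a)
cross-rebase (a₁ , a₂) (p₁ , p₂) (x₁ , x₂) = identity a₁ a₂ p₁ p₂ x₁ x₂
  where
  identity : ∀ a₁ a₂ p₁ p₂ x₁ x₂ →
    (a₁ - p₁) * (x₂ - p₂) - (a₂ - p₂) * (x₁ - p₁) ≡ (a₁ - p₁) * (x₂ - a₂) - (a₂ - p₂) * (x₁ - a₁)
  identity = solve-∀ ℚ-ring

cross-translate : ∀ e q c m u → cross e ((q ⊕ u · m) ⊖ c) ≡ cross e (q ⊖ c) + u * cross e m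
cross-translate (e₁ , e₂) (q₁ , q₂) (c₁ , c₂) (m₁ , m₂) u = identity e₁ e₂ q₁ q₂ c₁ c₂ m₁ m₂ u
  where
  identity : ∀ e₁ e₂ q₁ q₂ c₁ c₂ m₁ m₂ u →
    e₁ * ((q₂ + u * m₂) - c₂) - e₂ * ((q₁ + u * m₁) - c₁) ≡
    (e₁ * (q₂ - c₂) - e₂ * (q₁ - c₁)) + u * (e₁ * m₂ - e₂ * m₁)
  identity = solve-∀ ℚ-ring

cross-chord : ∀ m q t → cross m ((q ⊕ t · m) ⊖ q) ≡ 0ℚ × cross m (q ⊖ (q ⊕ t · m)) ≡ 0ℚ
cross-chord (m₁ , m₂) (q₁ , q₂) t = forward m₁ m₂ q₁ q₂ t , backward m₁ m₂ q₁ q₂ t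
  where
  forward : ∀ m₁ m₂ q₁ q₂ t → m₁ * ((q₂ + t * m₂) - q₂) - m₂ * ((q₁ + t * m₁) - q₁) ≡ 0ℚ
  forward = solve-∀ ℚ-ring
  backward : ∀ m₁ m₂ q₁ q₂ t → m₁ * (q₂ - (q₂ + t * m₂)) - m₂ * (q₁ - (q₁ + t * m₁)) ≡ 0ℚ
  backward = solve-∀ ℚ-ring

-- Cramer's rule: v · (a × b) = (a × v) b − (b × v) a.
cross≡0⇒≡origin : ∀ a b v → cross a b ≢ 0ℚ → cross a v ≡ 0ℚ → cross b v ≡ 0ℚ → v ≡ origin
cross≡0⇒≡origin a@(a₁ , a₂) b@(b₁ , b₂) v@(v₁ , v₂) a×b≢0 a×v≡0 b×v≡0 =
  cong₂ _,_ (coordinate v₁ b₁ a₁ (cramer a₁ a₂ b₁ b₂ v₁ v₂))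
            (coordinate v₂ b₂ a₂ (cramer′ a₁ a₂ b₁ b₂ v₁ v₂))
  where
  cramer : ∀ a₁ a₂ b₁ b₂ v₁ v₂ →
    v₁ * (a₁ * b₂ - a₂ * b₁) ≡ b₁ * (a₁ * v₂ - a₂ * v₁) - a₁ * (b₁ * v₂ - b₂ * v₁)
  cramer = solve-∀ ℚ-ring
  cramer′ : ∀ a₁ a₂ b₁ b₂ v₁ v₂ →
    v₂ * (a₁ * b₂ - a₂ * b₁) ≡ b₂ * (a₁ * v₂ - a₂ * v₁) - a₂ * (b₁ * v₂ - b₂ * v₁)
  cramer′ = solve-∀ ℚ-ring
  zero-combination : ∀ x y → x * 0ℚ - y * 0ℚ ≡ 0ℚ
  zero-combination = solve-∀ ℚ-ring
  coordinate : ∀ x y z → x * cross a b ≡ y * cross a v - z * cross b v → x ≡ 0ℚ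
  coordinate x y z eq = p*q≡0⇒p≡0 x (cross a b) a×b≢0 (begin
    x * cross a b                 ≡⟨ eq ⟩
    y * cross a v - z * cross b v ≡⟨ cong₂ (λ p q → y * p - z * q) a×v≡0 b×v≡0 ⟩
    y * 0ℚ - z * 0ℚ               ≡⟨ zero-combination y z ⟩
    0ℚ                            ∎)

toℕ-next : ∀ {n} (i : Fin n) → toℕ (next i) ≡ suc (toℕ i) ⊎ (toℕ (next i) ≡ 0 × suc (toℕ i) ≡ n)
toℕ-next {suc n} i with suc (toℕ i) <? suc n
... | yes 1+i<n = inj₁ (toℕ-fromℕ< 1+i<n)
... | no  1+i≮n = inj₂ (refl , ℕ.≤-antisym (toℕ<n i) (ℕ.≮⇒≥ 1+i≮n))

next-surjective : ∀ {n} (j : Fin n) → ∃ λ i → next i ≡ j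
next-surjective {suc n} fzero with toℕ-next (fromℕ n)
... | inj₁ e =
  ⊥-elim (ℕ.<-irrefl refl (subst (ℕ._< suc n) (trans e (cong suc (toℕ-fromℕ n))) (toℕ<n _)))
... | inj₂ (e , _) = fromℕ n , toℕ-injective e
next-surjective {suc n} (fsuc i) with toℕ-next (inject₁ i)
... | inj₁ e = inject₁ i , toℕ-injective (trans e (cong suc (toℕ-inject₁ i)))
... | inj₂ (_ , e) = ⊥-elim (ℕ.<-irrefl (trans (sym (toℕ-inject₁ i)) (ℕ.suc-injective e)) (toℕ<n i))

next≢id : ∀ {n} {i : Fin n} → 2 ℕ.≤ n → next i ≢ i
next≢id {n} {i} 2≤n loop with toℕ-next i
... | inj₁ y≡1+x = ℕ.1+n≢n (trans (sym y≡1+x) (cong toℕ loop))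
... | inj₂ (y≡0 , 1+x≡n) = ℕ.<⇒≱ 2≤n (ℕ.≤-reflexive (begin
  n           ≡⟨ sym 1+x≡n ⟩
  suc (toℕ i) ≡⟨ cong suc (trans (sym (cong toℕ loop)) y≡0) ⟩
  1           ∎))

next²≢id : ∀ {n} {i : Fin n} → 3 ℕ.≤ n → next (next i) ≢ i
next²≢id {n} {i} 3≤n loop = cases (toℕ-next i) (toℕ-next (next i))
  where
  x = toℕ i
  y = toℕ (next i)
  z = toℕ (next (next i))
  z≡x : z ≡ x
  z≡x = cong toℕ loop
  too-small : n ℕ.≤ 2 → ⊥
  too-small = ℕ.<⇒≱ 3≤n
  cases : y ≡ suc x ⊎ (y ≡ 0 × suc x ≡ n) → z ≡ suc y ⊎ (z ≡ 0 × suc y ≡ n) → ⊥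
  cases (inj₁ y≡1+x) (inj₁ z≡1+y) = ℕ.m+1+n≢n 1 (begin
    suc (suc x) ≡⟨ cong suc (sym y≡1+x) ⟩
    suc y       ≡⟨ sym z≡1+y ⟩
    z           ≡⟨ z≡x ⟩
    x           ∎)
  cases (inj₁ y≡1+x) (inj₂ (z≡0 , 1+y≡n)) = too-small (ℕ.≤-reflexive (begin
    n           ≡⟨ sym 1+y≡n ⟩
    suc y       ≡⟨ cong suc y≡1+x ⟩
    suc (suc x) ≡⟨ cong (suc ∘ suc) (trans (sym z≡x) z≡0) ⟩
    2           ∎))
  cases (inj₂ (y≡0 , 1+x≡n)) (inj₁ z≡1+y) = too-small (ℕ.≤-reflexive (begin
    n           ≡⟨ sym 1+x≡n ⟩
    suc x       ≡⟨ cong suc (sym z≡x) ⟩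
    suc z       ≡⟨ cong suc z≡1+y ⟩
    suc (suc y) ≡⟨ cong (suc ∘ suc) y≡0 ⟩
    2           ∎))
  cases (inj₂ (y≡0 , _)) (inj₂ (_ , 1+y≡n)) =
    too-small (ℕ.≤-trans (ℕ.≤-reflexive (trans (sym 1+y≡n) (cong suc y≡0))) (ℕ.n≤1+n 1))

consecutive⇒≢ : ∀ {l} {i j : Fin l} → toℕ j ≡ suc (toℕ i) → i ≢ j
consecutive⇒≢ j≡1+i refl = ℕ.1+n≢n (sym j≡1+i)

spread-by-consecutive-steps :
  ∀ {l} (Q : Fin l → Set) →
  (∀ i j → toℕ j ≡ suc (toℕ i) → Q i → Q j) →
  (∀ i j → toℕ j ≡ suc (toℕ i) → Q j → Q i) →
  ∀ k → Q k → ∀ i → Q i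
spread-by-consecutive-steps {suc l} Q forward backward k Q-k i =
  proj₂ (linked i) (proj₁ (linked k) Q-k)
  where
  linked : ∀ i → (Q i → Q fzero) × (Q fzero → Q i)
  linked = <-weakInduction _ (id , id) λ i (to₀ , from₀) →
    let step = cong suc (sym (toℕ-inject₁ i)) in
    to₀ ∘ backward _ _ step , forward _ _ step ∘ from₀

module _ (B : Polygon) where
  open Polygon B

  sideForm-parallel : ∀ s q m u → cross (edge B s) m ≡ 0ℚ → sideForm B s (q ⊕ u · m) ≡ sideForm B s q
  sideForm-parallel s q m u e×m≡0 = begin
    sideForm B s (q ⊕ u · m)                ≡⟨ cross-translate (edge B s) q (corner s) m u ⟩
    sideForm B s q + u * cross (edge B s) m ≡⟨ cong (λ c → sideForm B s q + u * c) e×m≡0 ⟩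
    sideForm B s q + u * 0ℚ                 ≡⟨ cong (sideForm B s q +_) (*-zeroʳ u) ⟩
    sideForm B s q + 0ℚ                     ≡⟨ +-identityʳ _ ⟩
    sideForm B s q                          ∎

  interior-line⇒transversal : ∀ {s q m u t} → sideForm B s (q ⊕ u · m) ≡ 0ℚ →
                              Interior B (q ⊕ t · m) → cross (edge B s) m ≢ 0ℚ
  interior-line⇒transversal {s} {q} {m} {u} {t} on-side interior parallel =
    <-irrefl (sym on-side′) (interior s)
    where
    on-side′ : sideForm B s (q ⊕ t · m) ≡ 0ℚ
    on-side′ = trans (sideForm-parallel s q m t parallel)
                     (trans (sym (sideForm-parallel s q m u parallel)) on-side)

  sideForm-from-end : ∀ j x → sideForm B j x ≡ cross (edge B j) (x ⊖ corner (next j))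
  sideForm-from-end j x = cross-rebase (corner (next j)) (corner j) x

  corner-on-side : ∀ j → sideForm B j (corner j) ≡ 0ℚ
  corner-on-side j = cross-⊖-self (edge B j) (corner j)

  corner-on-previous-side : ∀ j → sideForm B j (corner (next j)) ≡ 0ℚ
  corner-on-previous-side j =
    trans (sideForm-from-end j (corner (next j))) (cross-⊖-self (edge B j) (corner (next j)))

  edges-turn-left : ∀ j → 0ℚ < cross (edge B j) (edge B (next j))
  edges-turn-left j =
    subst (0ℚ <_) (sideForm-from-end j (corner (next (next j))))
      (convex j (next (next j)) (next²≢id 3≤n) (next≢id (ℕ.<⇒≤ 3≤n)))

dot-attackNormal : ∀ P r u v → dot (u ⊖ v) (attackNormal P r) ≡ cross (move P r) (v ⊖ u)
dot-attackNormal P r (u₁ , u₂) (v₁ , v₂) rewrite -‿/1 (Rider.c P r) =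
  identity u₁ u₂ v₁ v₂ (Rider.c P r / 1) (Rider.d P r / 1)
  where
  identity : ∀ u₁ u₂ v₁ v₂ c d →
    (u₁ - v₁) * d + (u₂ - v₂) * (- c) ≡ c * (v₂ - u₂) - d * (v₁ - u₁)
  identity = solve-∀ ℚ-ring

chord-attacks : ∀ P r p {q} t → q ≡ p ⊕ t · move P r →
                dot (p ⊖ q) (attackNormal P r) ≡ 0ℚ × dot (q ⊖ p) (attackNormal P r) ≡ 0ℚ
chord-attacks P r p t refl =
  trans (dot-attackNormal P r p _) (proj₁ (cross-chord (move P r) p t)) ,
  trans (dot-attackNormal P r _ p) (proj₂ (cross-chord (move P r) p t))

proper-antipode : ∀ B P {r p q} → Antipode B P r p q × q ≢ p →
                  MeetsInterior B P r p × Boundary B q × ∃ λ t → q ≡ p ⊕ t · move P r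
proper-antipode B P (inj₁ (_ , q≡p) , q≢p) = ⊥-elim (q≢p q≡p)
proper-antipode B P (inj₂ (meets , boundary , _ , on-line) , _) = meets , boundary , on-line

module _ (B : Polygon) (P : Rider) {l : ℕ} (b w : Fin l → Pt)
  (attacks : ∀ i j r → i ≢ j → dot (b i ⊖ b j) (attackNormal P r) ≡ 0ℚ →
                               dot (w i ⊖ w j) (attackNormal P r) ≡ 0ℚ)
  (fixations : ∀ i s → sideForm B s (b i) ≡ 0ℚ → cross (edge B s) (w i) ≡ 0ℚ) where

  vanishing-spreads : ∀ {i j} r s → i ≢ j → dot (b i ⊖ b j) (attackNormal P r) ≡ 0ℚ →
                      sideForm B s (b j) ≡ 0ℚ → cross (edge B s) (move P r) ≢ 0ℚ →
                      w i ≡ origin → w j ≡ origin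
  vanishing-spreads {i} {j} r s i≢j b-attack on-side transversal w-i≡0 =
    cross≡0⇒≡origin (edge B s) (move P r) (w j) transversal (fixations j s on-side) m×w-j≡0
    where
    m×w-j≡0 : cross (move P r) (w j) ≡ 0ℚ
    m×w-j≡0 = begin
      cross (move P r) (w j)             ≡⟨ cong (cross (move P r)) (sym (⊖-origin (w j))) ⟩
      cross (move P r) (w j ⊖ origin)    ≡⟨ cong (λ x → cross (move P r) (w j ⊖ x)) (sym w-i≡0) ⟩
      cross (move P r) (w j ⊖ w i)       ≡⟨ sym (dot-attackNormal P r (w i) (w j)) ⟩
      dot (w i ⊖ w j) (attackNormal P r) ≡⟨ attacks i j r i≢j b-attack ⟩
      0ℚ                                 ∎

  vanishes-at-corner : ∀ k → IsCorner B (b k) → w k ≡ origin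
  vanishes-at-corner k (j , b-k≡corner) with next-surjective j
  ... | p , refl =
    cross≡0⇒≡origin (edge B p) (edge B (next p)) (w k)
      (≢-sym (<⇒≢ (edges-turn-left B p)))
      (fixed p (corner-on-previous-side B p))
      (fixed (next p) (corner-on-side B (next p)))
    where
    fixed : ∀ s → sideForm B s (Polygon.corner B (next p)) ≡ 0ℚ → cross (edge B s) (w k) ≡ 0ℚ
    fixed s on-side = fixations k s (trans (cong (sideForm B s) b-k≡corner) on-side)

  module _ (T : Trajectory B P l b) where
    open Trajectory T

    vanishing-forward : ∀ i j → toℕ j ≡ suc (toℕ i) → w i ≡ origin → w j ≡ origin
    vanishing-forward i j j≡1+i with proper-antipode B P (step i j j≡1+i)
    ... | (t′ , interior) , (_ , s , on-side) , t , on-line =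
      vanishing-spreads (r i) s (consecutive⇒≢ j≡1+i)
        (proj₁ (chord-attacks P (r i) (b i) t on-line)) on-side
        (interior-line⇒transversal B {q = b i} {u = t} {t = t′}
          (trans (cong (sideForm B s) (sym on-line)) on-side) interior)

    vanishing-backward : ∀ i j → toℕ j ≡ suc (toℕ i) → w j ≡ origin → w i ≡ origin
    vanishing-backward i j j≡1+i with proper-antipode B P (step i j j≡1+i) | proj₂ (onBoundary i)
    ... | (t′ , interior) , _ , t , on-line | s , on-side =
      vanishing-spreads (r i) s (≢-sym (consecutive⇒≢ j≡1+i))
        (proj₂ (chord-attacks P (r i) (b i) t on-line)) on-side
        (interior-line⇒transversal B {q = b i} {u = 0ℚ} {t = t′}
          (trans (cong (sideForm B s) (⊕-zero· (b i) (move P (r i)))) on-side) interior)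

lemma5p6 : (B : Polygon) (P : Rider) (l : ℕ) (b : Fin l → Pt) →
             CornerTrajectory B P l b → FullRank B P l b
lemma5p6 B P l b (T , k , b-k-corner) w attacks fixations =
  spread-by-consecutive-steps (λ i → w i ≡ origin)
    (vanishing-forward B P b w attacks fixations T)
    (vanishing-backward B P b w attacks fixations T)
    k (vanishes-at-corner B P b w attacks fixations k b-k-corner)
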